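{- Let $(S,\bullet)$ be a right adequate partial semigroup and let $A\subseteq S$. (a) $A$ is partially thick if and only if $S\setminus A$ is not partially syndetic. (b) $A$ is partially syndetic if and only if $S\setminus A$ is not partially thick.
   Context: A partial semigroup is a nonempty set $S$ with a partially defined operation $\bullet$ such that $(x\bullet y)\bullet z=x\bullet(y\bullet z)$ in the sense that if either side is defined so is the other and they are equal. $R(x)=\{s:x\bullet s\text{ defined}\}$, $R(H)=\bigcap_{s\in H}R(s)$; $S$ is right adequate if $R(H)\ne\emptyset$ for every finite nonempty $H\subseteq S$. $\beta S$ is the set of ultrafilters on $S$; for $p\in\beta S$, $L(p)=\{s\in S:R(s)\in p\}$; $\mathcal P_f(Y)$ is the set of finite nonempty subsets of $Y$; $s^{ -1}A=\{t\in R(s):s\bullet t\in A\}$; $F\bullet t=\{s\bullet t:s\in F\}$. $A$ is partially syndetic if for every $p\in\beta S$ there is $H\in\mathcal P_f(L(p))$ with $R(H)\subseteq\bigcup_{t\in H}t^{ -1}A$. $A$ is partially thick if there exists $p\in\beta S$ such that for every $F\in\mathcal P_f(L(p))$ there exists $t\in R(F)$ with $F\bullet t\subseteq A$. -}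

module Defs where

open import Level using (0ℓ)
open import Data.Maybe using (Maybe; just; nothing; _>>=_)
open import Data.Product using (Σ; ∃; ∃-syntax; _×_; _,_)
open import Data.Sum using (_⊎_)
open import Data.List.NonEmpty using (List⁺; toList)
open import Data.List.Membership.Propositional using (_∈_)
open import Relation.Nullary using (¬_)
open import Relation.Unary using (Pred; _⊆_; U; ∅; _∩_; ∁)
open import Relation.Binary.PropositionalEquality using (_≡_)

-- A partial semigroup: the partial operation is modelled as a total
-- function into Maybe S (nothing = undefined).  Associativity in the
-- strong sense ("either side defined iff the other is, and then equal")
-- is exactly equality of the two Maybe-values obtained by composing.
record PartialSemigroup : Set₁ where
  infixl 7 _•_
  field
    Carrier : Set
    nonempty : Carrier
    _•_ : Carrier → Carrier → Maybe Carrier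
    assoc : ∀ x y z →
      ((x • y) >>= λ w → w • z) ≡ ((y • z) >>= λ w → x • w)

record Ultrafilter (S : Set) : Set₁ where
  field
    mem      : Pred S 0ℓ → Set
    full     : mem U
    ∅∉       : ¬ mem ∅
    ∩-closed : ∀ {A B} → mem A → mem B → mem (A ∩ B)
    upward   : ∀ {A B} → A ⊆ B → mem A → mem B
    ultra    : ∀ A → mem A ⊎ mem (∁ A)

module _ (PS : PartialSemigroup) where
  open PartialSemigroup PS

  S : Set
  S = Carrier

  Defined : S → S → Set
  Defined x s = ∃[ v ] (x • s ≡ just v)

  R : S → Pred S 0ℓ
  R x s = Defined x s

  -- R(H) = ⋂_{s ∈ H} R(s), H a finite nonempty subset (nonempty list)
  Rᶠ : List⁺ S → Pred S 0ℓ
  Rᶠ H t = ∀ {s} → s ∈ toList H → R s t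

  RightAdequate : Set
  RightAdequate = ∀ (H : List⁺ S) → ∃[ t ] Rᶠ H t

  L : Ultrafilter S → Pred S 0ℓ
  L p s = Ultrafilter.mem p (R s)

  FinSubsetOf : Pred S 0ℓ → List⁺ S → Set
  FinSubsetOf Y H = ∀ {s} → s ∈ toList H → Y s

  _⁻¹_ : S → Pred S 0ℓ → Pred S 0ℓ
  (s ⁻¹ A) t = ∃[ v ] (s • t ≡ just v × A v)

  ⋃⁻¹ : List⁺ S → Pred S 0ℓ → Pred S 0ℓ
  ⋃⁻¹ H A x = ∃[ t ] (t ∈ toList H × (t ⁻¹ A) x)

  _•ᶠ_⊆_ : List⁺ S → S → Pred S 0ℓ → Set
  F •ᶠ t ⊆ A = ∀ {s} → s ∈ toList F → ∃[ v ] (s • t ≡ just v × A v)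

  PartiallySyndetic : Pred S 0ℓ → Set₁
  PartiallySyndetic A =
    ∀ (p : Ultrafilter S) →
      ∃[ H ] (FinSubsetOf (L p) H × (Rᶠ H ⊆ ⋃⁻¹ H A))

  PartiallyThick : Pred S 0ℓ → Set₁
  PartiallyThick A =
    ∃[ p ] (∀ (F : List⁺ S) → FinSubsetOf (L p) F →
              ∃[ t ] (Rᶠ F t × (F •ᶠ t ⊆ A)))

module Submission where

open import Defs
open import Level using (0ℓ; _⊔_; lift; lower)
open import Data.Product using (_×_; _,_; ∃)
open import Data.Maybe.Properties using (just-injective)
open import Function using (_∘_)
open import Function.Bundles using (_⇔_; mk⇔)
open import Relation.Nullary using (¬_)
open import Relation.Nullary.Decidable using (map′)
open import Relation.Unary using (Pred; _⊆_; ∁)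
open import Relation.Binary.PropositionalEquality using (trans; sym; subst)
open import Axiom.ExcludedMiddle using (ExcludedMiddle)
open import Axiom.DoubleNegationElimination using (DoubleNegationElimination; em⇒dne)

-- Thickness and syndeticity are the two De Morgan duals of one another:
-- "∃ p, ∀ F ⊆ L(p), ∃ t ∈ R(F), F • t ⊆ A" negated is
-- "∀ p, ∃ H ⊆ L(p), ∀ t ∈ R(H), ∃ s ∈ H, s • t ∉ A", and since t ∈ R(H)
-- makes every s • t defined, "s • t ∉ A" is "t ∈ s⁻¹(S ∖ A)".

¬∀⇒∃¬ : ∀ {a b} → DoubleNegationElimination (a ⊔ b) → DoubleNegationElimination b →
        {X : Set a} {P : X → Set b} → ¬ (∀ x → P x) → ∃ (¬_ ∘ P)
¬∀⇒∃¬ dne dne′ ¬∀P = dne λ ¬∃¬P → ¬∀P λ x → dne′ λ ¬Px → ¬∃¬P (x , ¬Px)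

¬⊆⇒∃∖ : ∀ {a} → DoubleNegationElimination a →
        {X : Set a} {P Q : Pred X a} → ¬ (P ⊆ Q) → ∃ λ x → P x × ¬ Q x
¬⊆⇒∃∖ dne ¬P⊆Q = dne λ ¬∃ → ¬P⊆Q λ {x} Px → dne λ ¬Qx → ¬∃ (x , Px , ¬Qx)

module _ (PS : PartialSemigroup) where

  ⋃⁻¹-mono : ∀ {H A B} → A ⊆ B → ⋃⁻¹ PS H A ⊆ ⋃⁻¹ PS H B
  ⋃⁻¹-mono A⊆B (s , s∈H , v , st≡v , Av) = s , s∈H , v , st≡v , A⊆B Av

  •ᶠ⊆-mono : ∀ {F t A B} → A ⊆ B → _•ᶠ_⊆_ PS F t A → _•ᶠ_⊆_ PS F t B
  •ᶠ⊆-mono A⊆B F•t⊆A s∈F with v , st≡v , Av ← F•t⊆A s∈F = v , st≡v , A⊆B Av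

  syndetic-mono : ∀ {A B} → A ⊆ B → PartiallySyndetic PS A → PartiallySyndetic PS B
  syndetic-mono A⊆B syndetic p with H , H⊆Lp , cover ← syndetic p =
    H , H⊆Lp , ⋃⁻¹-mono A⊆B ∘ cover

  thick-mono : ∀ {A B} → A ⊆ B → PartiallyThick PS A → PartiallyThick PS B
  thick-mono A⊆B (p , thick) = p , λ F F⊆Lp →
    let t , t∈RF , F•t⊆A = thick F F⊆Lp in t , t∈RF , •ᶠ⊆-mono A⊆B F•t⊆A

  •ᶠ⊆⇒∉⋃⁻¹∁ : ∀ {F t A} → _•ᶠ_⊆_ PS F t A → ¬ ⋃⁻¹ PS F (∁ A) t
  •ᶠ⊆⇒∉⋃⁻¹∁ {A = A} F•t⊆A (s , s∈F , v , st≡v , ¬Av) with v′ , st≡v′ , Av′ ← F•t⊆A s∈F =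
    ¬Av (subst A (just-injective (trans (sym st≡v′) st≡v)) Av′)

  ∉⋃⁻¹⇒•ᶠ⊆∁ : ∀ {F t A} → Rᶠ PS F t → ¬ ⋃⁻¹ PS F A t → _•ᶠ_⊆_ PS F t (∁ A)
  ∉⋃⁻¹⇒•ᶠ⊆∁ t∈RF t∉⋃ {s} s∈F with v , st≡v ← t∈RF s∈F =
    v , st≡v , λ Av → t∉⋃ (s , s∈F , v , st≡v , Av)

  thick⇒¬syndetic-∁ : ∀ {A} → PartiallyThick PS A → ¬ PartiallySyndetic PS (∁ A)
  thick⇒¬syndetic-∁ (p , thick) syndetic with H , H⊆Lp , cover ← syndetic p
    with t , t∈RH , H•t⊆A ← thick H H⊆Lp = •ᶠ⊆⇒∉⋃⁻¹∁ H•t⊆A (cover t∈RH)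

  module _ (dne₁ : DoubleNegationElimination (Level.suc 0ℓ))
           (dne₀ : DoubleNegationElimination 0ℓ) where

    ¬syndetic⇒thick-∁ : ∀ {A} → ¬ PartiallySyndetic PS A → PartiallyThick PS (∁ A)
    ¬syndetic⇒thick-∁ {A} ¬syndetic with p , ¬coverable ← ¬∀⇒∃¬ dne₁ dne₀ ¬syndetic =
      p , λ F F⊆Lp →
        let t , t∈RF , t∉⋃ = ¬⊆⇒∃∖ dne₀ {P = Rᶠ PS F} {Q = ⋃⁻¹ PS F A}
                                     (λ cover → ¬coverable (F , F⊆Lp , cover))
        in t , t∈RF , ∉⋃⁻¹⇒•ᶠ⊆∁ t∈RF t∉⋃

theorem2p20 : ExcludedMiddle (Level.suc 0ℓ) →
    (PS : PartialSemigroup) → RightAdequate PS →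
    (A : Pred (S PS) 0ℓ) →
    (PartiallyThick PS A ⇔ (¬ PartiallySyndetic PS (∁ A)))
    × (PartiallySyndetic PS A ⇔ (¬ PartiallyThick PS (∁ A)))
theorem2p20 em PS _ _ =
  mk⇔ (thick⇒¬syndetic-∁ PS) (thick-mono PS dne₀ ∘ ¬syndetic⇒thick-∁′) ,
  mk⇔ (λ syndetic thick → thick⇒¬syndetic-∁ PS thick (syndetic-mono PS (λ Av ¬Av → ¬Av Av) syndetic))
      (λ ¬thick → dne₁ (¬thick ∘ ¬syndetic⇒thick-∁′))
  where
  dne₁ : DoubleNegationElimination (Level.suc 0ℓ)
  dne₁ = em⇒dne em

  dne₀ : DoubleNegationElimination 0ℓ
  dne₀ = em⇒dne (map′ lower lift em)

  ¬syndetic⇒thick-∁′ : ∀ {B} → ¬ PartiallySyndetic PS B → PartiallyThick PS (∁ B)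
  ¬syndetic⇒thick-∁′ = ¬syndetic⇒thick-∁ PS dne₁ dne₀
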